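{- Let $d\geq 2$ and $m\geq 1$. Let $H_1$ and $H_2$ be two bipartite graphs with the same vertex classes $A_1$ and $A_2$, and let $S$ be a forest containing $X\subset V(S)\cap A_1$ such that each tree of $S$ contains exactly one vertex of $X$. Suppose that $(S,X)$ is $(d,m)$-extendable in $(H_1,H_2)$ and $|S|\leq \min\{|A_1|,|A_2|\}/2-2dm-2$. Then for each $i\in[2]$ and each $x\in V(S)\cap A_i$ with $d_S(x)<d$, there exists $y\in N_{H_i}(x)\setminus V(S)$ such that $(S+xy,X)$ is $(d,m)$-extendable in $(H_1,H_2)$.
   Context: For a forest $S$, a set $X\subset V(S)$ with exactly one vertex in each tree of $S$, and an edge $e\in E(S)$, $d(e,X)$ is the length of the shortest path in $S$ from a vertex of $e$ to a vertex of $X$. Given bipartite graphs $H_1,H_2$ with the same vertex classes $A_1,A_2$, and such $S$ with $X\subset V(S)\cap A_1$, let $S_i$ ($i\in[2]$) be the subgraph of $S$ with edge set $\{e\in E(S): d(e,X)\equiv i+1\pmod 2\}$. Then $(S,X)$ is $(d,m)$-extendable in $(H_1,H_2)$ if: (1) $\Delta(S)\leq d$; (2) $S_i\subset H_i$ for each $i$; (3) for each $i\in[2]$ and $U\subset A_i$ with $0<|U|\leq 2m$, $|N_{H_i}(U)\setminus V(S)|\geq d|U|-e_{S_i}(U,A_{3-i})$; (4) for each $i\in[2]$ and $U\subset A_i$ with $|U|\geq m$, $|N_{H_i}(U)|\geq|A_{3-i}|/2$. Here $|S|=|V(S)|$, $e_{S_i}(U,A_{3-i})$ is the number of edges of $S_i$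 between $U$ and $A_{3-i}$, and $S+xy$ is $S$ with the vertex $y$ and edge $xy$ added. -}

module Defs where

open import Data.Bool using (Bool; true; false; _∧_; _∨_; not; if_then_else_)
open import Data.Nat using (ℕ; zero; suc; _+_; _*_; _≤_; _<_; _%_)
open import Data.Fin using (Fin; zero; suc; toℕ; inject₁; fromℕ)
open import Data.Fin.Subset using (Subset; _∈_; _∉_; _⊆_; ∣_∣; ⁅_⁆; _∪_)
open import Data.Vec using (Vec; tabulate; lookup; sum)
open import Data.Product using (Σ; _×_; ∃; ∃-syntax)
open import Relation.Binary.PropositionalEquality using (_≡_; _≢_)
open import Relation.Nullary using (¬_)
open import Function.Definitions using (Injective)
open import Relation.Nullary.Decidable using (⌊_⌋)
open import Data.Fin.Properties using () renaming (_≟_ to _≟ᶠ_)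

Adj : ℕ → Set
Adj n = Fin n → Fin n → Bool

anyV : ∀ {n} → (Fin n → Bool) → Bool
anyV {zero}  f = false
anyV {suc n} f = f zero ∨ anyV (λ j → f (suc j))

record IsSimple {n : ℕ} (E : Adj n) : Set where
  field
    sym     : ∀ u v → E u v ≡ E v u
    noLoops : ∀ u → E u u ≡ false

-- Vertex classes: cls v = 0 means v ∈ A₁, cls v = 1 means v ∈ A₂.
-- An index i ∈ [2] is represented by i : Fin 2 (zero ↦ 1, suc zero ↦ 2).
other : Fin 2 → Fin 2
other zero = suc zero
other (suc _) = zero

class : ∀ {n} → (Fin n → Fin 2) → Fin 2 → Subset n
class cls i = tabulate (λ v → ⌊ cls v ≟ᶠ i ⌋)

record IsBipartite {n : ℕ} (cls : Fin n → Fin 2) (H : Adj n) : Set where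
  field
    simple  : IsSimple H
    crosses : ∀ u v → H u v ≡ true → cls u ≢ cls v

record Graph (n : ℕ) : Set where
  constructor mkGraph
  field
    V : Subset n
    E : Adj n
open Graph public

record IsSubgraphShape {n : ℕ} (S : Graph n) : Set where
  field
    simple  : IsSimple (E S)
    inside  : ∀ u v → E S u v ≡ true → u ∈ V S

data Walk {n : ℕ} (S : Graph n) : Fin n → Fin n → ℕ → Set where
  here : ∀ {u} → u ∈ V S → Walk S u u zero
  step : ∀ {u v w k} → E S u v ≡ true → Walk S v w k → Walk S u w (suc k)

Connected : ∀ {n} → Graph n → Fin n → Fin n → Set
Connected S u v = ∃[ k ] Walk S u v k

record Cycle {n : ℕ} (S : Graph n) : Set where
  field
    len      : ℕ
    c        : Fin (suc (suc (suc len))) → Fin n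
    distinct : Injective _≡_ _≡_ c
    edges    : ∀ (j : Fin (suc (suc len))) → E S (c (inject₁ j)) (c (suc j)) ≡ true
    closing  : E S (c (fromℕ (suc (suc len)))) (c zero) ≡ true

IsForest : ∀ {n} → Graph n → Set
IsForest S = IsSubgraphShape S × ¬ Cycle S

IsRootSet : ∀ {n} → (Fin n → Fin 2) → Graph n → Subset n → Set
IsRootSet cls S X =
  (∀ x → x ∈ X → x ∈ V S × cls x ≡ zero) ×
  (∀ v → v ∈ V S → ∃[ x ] (x ∈ X × Connected S v x)) ×
  (∀ v x x′ → x ∈ X → x′ ∈ X → Connected S v x → Connected S v x′ → x ≡ x′)

reach : ∀ {n} → Graph n → Subset n → ℕ → Fin n → Bool
reach S X zero    v = lookup X v
reach S X (suc k) v = reach S X k v ∨ anyV (λ w → E S v w ∧ reach S X k w)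

-- least k < b with f k = true (returns b if there is none)
search : (ℕ → Bool) → ℕ → ℕ
search f zero    = zero
search f (suc b) = if f zero then zero else suc (search (λ k → f (suc k)) b)

-- d(uv, X): length of a shortest path in S from u or v to a vertex of X
-- (all such distances in a graph on n vertices are < n)
dist : ∀ {n} → Graph n → Subset n → Fin n → Fin n → ℕ
dist {n} S X u v = search (λ k → reach S X k u ∨ reach S X k v) n

-- S_i: edges e with d(e,X) ≡ i+1 (mod 2); with i ∈ {0,1} encoding [2] this is d % 2 ≡ i
parityOk : ℕ → Fin 2 → Bool
parityOk k i = ⌊ (k % 2) Data.Nat.≟ toℕ i ⌋

Sᵢ : ∀ {n} → Graph n → Subset n → Fin 2 → Adj n
Sᵢ S X i u v = E S u v ∧ parityOk (dist S X u v) i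

deg : ∀ {n} → Graph n → Fin n → ℕ
deg S x = ∣ tabulate (E S x) ∣

N : ∀ {n} → Adj n → Subset n → Subset n
N H U = tabulate (λ v → anyV (λ u → lookup U u ∧ H u v))

Nout : ∀ {n} → Adj n → Subset n → Graph n → Subset n
Nout H U S = tabulate (λ v → anyV (λ u → lookup U u ∧ H u v) ∧ not (lookup (V S) v))

eS : ∀ {n} → (Fin n → Fin 2) → Graph n → Subset n → Fin 2 → Subset n → ℕ
eS cls S X i U =
  sum (tabulate (λ u → if lookup U u
                        then ∣ tabulate (λ v → Sᵢ S X i u v ∧ lookup (class cls (other i)) v) ∣
                        else 0))

-- (S, X) is (d, m)-extendable in (H₁, H₂)   (H i is H_{i+1})
record Extendable {n : ℕ} (cls : Fin n → Fin 2) (H : Fin 2 → Adj n)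
                  (S : Graph n) (X : Subset n) (d m : ℕ) : Set where
  field
    maxDeg : ∀ v → deg S v ≤ d
    sub    : ∀ i u v → Sᵢ S X i u v ≡ true → H i u v ≡ true
    expand : ∀ i (U : Subset n) → U ⊆ class cls i → 0 < ∣ U ∣ → ∣ U ∣ ≤ 2 * m →
             d * ∣ U ∣ ≤ ∣ Nout (H i) U S ∣ + eS cls S X i U
    large  : ∀ i (U : Subset n) → U ⊆ class cls i → m ≤ ∣ U ∣ →
             ∣ class cls (other i) ∣ ≤ 2 * ∣ N (H i) U ∣

addEdge : ∀ {n} → Graph n → Fin n → Fin n → Graph n
addEdge S x y = mkGraph (V S ∪ ⁅ y ⁆)
  (λ u v → E S u v ∨ (⌊ u ≟ᶠ x ⌋ ∧ ⌊ v ≟ᶠ y ⌋) ∨ (⌊ u ≟ᶠ y ⌋ ∧ ⌊ v ≟ᶠ x ⌋))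

module Submission where

-- Call T ⊆ A_i tight if x ∉ T, |T| ≤ 2m and |N_{H_i}(T) ∖ V(S)| + e_{S_i}(T, A_{3-i}) ≤ d|T|.
-- The left-hand side is submodular in T, and condition (3) bounds it below by d|T ∩ T′| on
-- intersections, so tight sets are closed under union; condition (4) and the bound on |S|
-- force every tight set to have fewer than m vertices. If every H_i-neighbour y ∉ V(S) of x
-- were a new neighbour of some tight set, the union P of these sets would be tight and
-- P ∪ {x} would violate (3), since x adds at most d_S(x) < d edges of S_i. So some such y is
-- a new neighbour of no tight set, and S + xy is extendable: the new edge has distance d(x, X)
-- to the roots, whose parity is the class of x, so it lies in S_i; and a set U that loses y
-- from its new neighbourhood is either paid for by the edge xy (when x ∈ U) or is not tight.

open import Defs
open import Data.Bool using (Bool; true; false; _∧_; _∨_; not; if_then_else_)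
open import Data.Bool.Properties using (¬-not; not-¬; not-injective; ∨-comm) renaming (_≟_ to _≟ᵇ_)
open import Data.Empty using (⊥-elim)
open import Data.Fin using (Fin; zero; suc; toℕ)
open import Data.Fin.Properties using (toℕ-injective; any?) renaming (_≟_ to _≟ᶠ_)
open import Data.Fin.Subset using (Subset; _∈_; _∉_; _⊆_; _⊂_; ∣_∣; ⁅_⁆; _∪_; _∩_; inside; outside)
  renaming (⊥ to ∅)
open import Data.Fin.Subset.Properties
  using ( _∈?_; _⊆?_; anySubset?; ∈⊤; ∉⊥; ∣⊥∣≡0; ∣p∣≤n; ∣p∣≡n⇒p≡⊤; p⊆q⇒∣p∣≤∣q∣; p⊂q⇒∣p∣<∣q∣
        ; x∈⁅x⁆; x∈⁅y⁆⇒x≡y; ∣⁅x⁆∣≡1; x∈p∪q⁺; x∈p∪q⁻; p⊆p∪q; q⊆p∪q; x∈p∩q⁺; p∩q⊆p; p∩q⊆q )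
open import Data.List using (List; []; _∷_; filter; allFin)
open import Data.List.Membership.Propositional using () renaming (_∈_ to _∈ₗ_)
open import Data.List.Membership.Propositional.Properties using (∈-filter⁺; ∈-filter⁻; ∈-allFin)
open import Data.List.Relation.Unary.Any using () renaming (here to hereₗ; there to thereₗ)
open import Data.Nat using (ℕ; zero; suc; _+_; _*_; _≤_; _<_; z≤n; s≤s; _%_; _≟_; _≤?_)
open import Data.Nat.Properties
open import Data.Nat.Tactic.RingSolver using (solve-∀)
open import Algebra.Properties.CommutativeSemigroup +-commutativeSemigroup
  using () renaming (interchange to +-interchange; x∙yz≈y∙xz to x+[y+z]≡y+[x+z])
open import Data.Product using (_×_; _,_; proj₁; proj₂; ∃-syntax)
open import Data.Sum using (_⊎_; inj₁; inj₂)
open import Data.Vec using ([]; _∷_; here; there; tabulate; lookup; sum)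
open import Data.Vec.Properties using (lookup∘tabulate; []=⇒lookup; lookup⇒[]=)
open import Function using (_∘_)
open import Relation.Binary.PropositionalEquality
open import Relation.Nullary using (¬_; Dec; yes; no; _×-dec_)
open import Relation.Nullary.Decidable using (⌊_⌋; map′; ¬?; decidable-stable)

∨≡true⁺ˡ : ∀ {a} b → a ≡ true → a ∨ b ≡ true
∨≡true⁺ˡ b refl = refl

∨≡true⁺ʳ : ∀ a {b} → b ≡ true → a ∨ b ≡ true
∨≡true⁺ʳ true  _ = refl
∨≡true⁺ʳ false p = p

∨≡true⁻ : ∀ a {b} → a ∨ b ≡ true → a ≡ true ⊎ b ≡ true
∨≡true⁻ true  _ = inj₁ refl
∨≡true⁻ false p = inj₂ p

∨-redundantʳ : ∀ a {b} → (b ≡ true → a ≡ true) → a ∨ b ≡ a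
∨-redundantʳ true          _   = refl
∨-redundantʳ false {false} _   = refl
∨-redundantʳ false {true}  b⇒a = sym (b⇒a refl)

Bool-ext : ∀ {a b} → (a ≡ true → b ≡ true) → (b ≡ true → a ≡ true) → a ≡ b
Bool-ext {false} {false} _   _   = refl
Bool-ext {false} {true}  _   b⇒a = b⇒a refl
Bool-ext {true}  {false} a⇒b _   = sym (a⇒b refl)
Bool-ext {true}  {true}  _   _   = refl

∧≡true⁺ : ∀ {a b} → a ≡ true → b ≡ true → a ∧ b ≡ true
∧≡true⁺ refl refl = refl

∧≡true⁻ : ∀ a {b} → a ∧ b ≡ true → a ≡ true × b ≡ true
∧≡true⁻ true p = refl , p

⌊⌋≡true⁺ : ∀ {ℓ} {A : Set ℓ} (a? : Dec A) → A → ⌊ a? ⌋ ≡ true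
⌊⌋≡true⁺ (yes _) _ = refl
⌊⌋≡true⁺ (no ¬a) a = ⊥-elim (¬a a)

⌊⌋≡true⁻ : ∀ {ℓ} {A : Set ℓ} (a? : Dec A) → ⌊ a? ⌋ ≡ true → A
⌊⌋≡true⁻ (yes a) _ = a

anyV⁺ : ∀ {n} (f : Fin n → Bool) w → f w ≡ true → anyV f ≡ true
anyV⁺ f zero    p = ∨≡true⁺ˡ _ p
anyV⁺ f (suc w) p = ∨≡true⁺ʳ (f zero) (anyV⁺ (f ∘ suc) w p)

anyV⁻ : ∀ {n} (f : Fin n → Bool) → anyV f ≡ true → ∃[ w ] f w ≡ true
anyV⁻ {suc n} f p with ∨≡true⁻ (f zero) p
... | inj₁ q = zero , q
... | inj₂ q with anyV⁻ (f ∘ suc) q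
...   | w , r = suc w , r

anyV-cong : ∀ {n} {f g : Fin n → Bool} → (∀ w → f w ≡ g w) → anyV f ≡ anyV g
anyV-cong {zero}  _ = refl
anyV-cong {suc n} e = cong₂ _∨_ (e zero) (anyV-cong (e ∘ suc))

parity : ℕ → Fin 2
parity zero          = zero
parity (suc zero)    = suc zero
parity (suc (suc k)) = parity k

toℕ-parity : ∀ k → toℕ (parity k) ≡ k % 2
toℕ-parity zero          = refl
toℕ-parity (suc zero)    = refl
toℕ-parity (suc (suc k)) = toℕ-parity k

parity-suc : ∀ k → parity (suc k) ≡ other (parity k)
parity-suc zero          = refl
parity-suc (suc zero)    = refl
parity-suc (suc (suc k)) = parity-suc k

parityOk-parity : ∀ k → parityOk k (parity k) ≡ true
parityOk-parity k = ⌊⌋≡true⁺ (k % 2 ≟ toℕ (parity k)) (sym (toℕ-parity k))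

parityOk⇒≡parity : ∀ k {j} → parityOk k j ≡ true → j ≡ parity k
parityOk⇒≡parity k {j} p =
  toℕ-injective (trans (sym (⌊⌋≡true⁻ (k % 2 ≟ toℕ j) p)) (sym (toℕ-parity k)))

other-injective : ∀ {a b} → other a ≡ other b → a ≡ b
other-injective {zero}     {zero}     _ = refl
other-injective {suc zero} {suc zero} _ = refl

≢⇒≡other : ∀ {a b : Fin 2} → a ≢ b → b ≡ other a
≢⇒≡other {zero}     {zero}     a≢b = ⊥-elim (a≢b refl)
≢⇒≡other {zero}     {suc zero} _   = refl
≢⇒≡other {suc zero} {zero}     _   = refl
≢⇒≡other {suc zero} {suc zero} a≢b = ⊥-elim (a≢b refl)

∈-tabulate⁺ : ∀ {n} {f : Fin n → Bool} {v} → f v ≡ true → v ∈ tabulate f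
∈-tabulate⁺ {f = f} {v} p = lookup⇒[]= v (tabulate f) (trans (lookup∘tabulate f v) p)

∈-tabulate⁻ : ∀ {n} {f : Fin n → Bool} {v} → v ∈ tabulate f → f v ≡ true
∈-tabulate⁻ {f = f} {v} p = trans (sym (lookup∘tabulate f v)) ([]=⇒lookup p)

tabulate-⊆ : ∀ {n} {f g : Fin n → Bool} → (∀ v → f v ≡ true → g v ≡ true) → tabulate f ⊆ tabulate g
tabulate-⊆ f⇒g v∈f = ∈-tabulate⁺ (f⇒g _ (∈-tabulate⁻ v∈f))

∉⇒lookup≡false : ∀ {n} {p : Subset n} {v} → v ∉ p → lookup p v ≡ false
∉⇒lookup≡false {p = p} {v} v∉p = ¬-not (v∉p ∘ lookup⇒[]= v p)

lookup≡false⇒∉ : ∀ {n} {p : Subset n} {v} → lookup p v ≡ false → v ∉ p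
lookup≡false⇒∉ p[v]≡false v∈p with () ← trans (sym ([]=⇒lookup v∈p)) p[v]≡false

∈-class⁺ : ∀ {n} {cls : Fin n → Fin 2} {j v} → cls v ≡ j → v ∈ class cls j
∈-class⁺ {cls = cls} {j} {v} p = ∈-tabulate⁺ (⌊⌋≡true⁺ (cls v ≟ᶠ j) p)

∈-class⁻ : ∀ {n} {cls : Fin n → Fin 2} {j v} → v ∈ class cls j → cls v ≡ j
∈-class⁻ {cls = cls} {j} {v} p = ⌊⌋≡true⁻ (cls v ≟ᶠ j) (∈-tabulate⁻ p)

∣p∪q∣+∣p∩q∣≡∣p∣+∣q∣ : ∀ {n} (p q : Subset n) → ∣ p ∪ q ∣ + ∣ p ∩ q ∣ ≡ ∣ p ∣ + ∣ q ∣
∣p∪q∣+∣p∩q∣≡∣p∣+∣q∣ []            []            = refl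
∣p∪q∣+∣p∩q∣≡∣p∣+∣q∣ (outside ∷ p) (outside ∷ q) = ∣p∪q∣+∣p∩q∣≡∣p∣+∣q∣ p q
∣p∪q∣+∣p∩q∣≡∣p∣+∣q∣ (outside ∷ p) (inside  ∷ q) =
  trans (cong suc (∣p∪q∣+∣p∩q∣≡∣p∣+∣q∣ p q)) (sym (+-suc ∣ p ∣ ∣ q ∣))
∣p∪q∣+∣p∩q∣≡∣p∣+∣q∣ (inside  ∷ p) (outside ∷ q) = cong suc (∣p∪q∣+∣p∩q∣≡∣p∣+∣q∣ p q)
∣p∪q∣+∣p∩q∣≡∣p∣+∣q∣ (inside  ∷ p) (inside  ∷ q) =
  cong suc (trans (+-suc ∣ p ∪ q ∣ ∣ p ∩ q ∣)
                  (trans (cong suc (∣p∪q∣+∣p∩q∣≡∣p∣+∣q∣ p q)) (sym (+-suc ∣ p ∣ ∣ q ∣))))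

∣p∪q∣≤∣p∣+∣q∣ : ∀ {n} (p q : Subset n) → ∣ p ∪ q ∣ ≤ ∣ p ∣ + ∣ q ∣
∣p∪q∣≤∣p∣+∣q∣ p q = ≤-trans (m≤m+n ∣ p ∪ q ∣ ∣ p ∩ q ∣) (≤-reflexive (∣p∪q∣+∣p∩q∣≡∣p∣+∣q∣ p q))

∣p∪⁅x⁆∣≡1+∣p∣ : ∀ {n} {p : Subset n} {x} → x ∉ p → ∣ p ∪ ⁅ x ⁆ ∣ ≡ suc ∣ p ∣
∣p∪⁅x⁆∣≡1+∣p∣ {p = p} {x} x∉p = ≤-antisym
  (begin
    ∣ p ∪ ⁅ x ⁆ ∣        ≤⟨ ∣p∪q∣≤∣p∣+∣q∣ p ⁅ x ⁆ ⟩
    ∣ p ∣ + ∣ ⁅ x ⁆ ∣    ≡⟨ cong (∣ p ∣ +_) (∣⁅x⁆∣≡1 x) ⟩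
    ∣ p ∣ + 1            ≡⟨ +-comm (∣ p ∣) 1 ⟩
    suc ∣ p ∣            ∎)
  (p⊂q⇒∣p∣<∣q∣ (p⊆p∪q ⁅ x ⁆ , x , x∈p∪q⁺ (inj₂ (x∈⁅x⁆ x)) , x∉p))
  where open ≤-Reasoning

-- eS cls G X j is definitionally weight (degInto (Sᵢ G X j) (class cls (other j))).
weight : ∀ {n} → (Fin n → ℕ) → Subset n → ℕ
weight c U = sum (tabulate (λ u → if lookup U u then c u else 0))

weight-∅ : ∀ {n} (c : Fin n → ℕ) → weight c ∅ ≡ 0
weight-∅ {zero}  c = refl
weight-∅ {suc n} c = weight-∅ (c ∘ suc)

weight-⁅⁆ : ∀ {n} (c : Fin n → ℕ) x → weight c ⁅ x ⁆ ≡ c x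
weight-⁅⁆ c zero    = trans (cong (c zero +_) (weight-∅ (c ∘ suc))) (+-identityʳ (c zero))
weight-⁅⁆ c (suc x) = weight-⁅⁆ (c ∘ suc) x

weight-∪-∩ : ∀ {n} (c : Fin n → ℕ) (p q : Subset n) →
             weight c (p ∪ q) + weight c (p ∩ q) ≡ weight c p + weight c q
weight-∪-∩ c []            []            = refl
weight-∪-∩ c (outside ∷ p) (outside ∷ q) = weight-∪-∩ (c ∘ suc) p q
weight-∪-∩ c (outside ∷ p) (inside  ∷ q) = begin
  (c zero + w (p ∪ q)) + w (p ∩ q)  ≡⟨ +-assoc (c zero) (w (p ∪ q)) (w (p ∩ q)) ⟩
  c zero + (w (p ∪ q) + w (p ∩ q))  ≡⟨ cong (c zero +_) (weight-∪-∩ (c ∘ suc) p q) ⟩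
  c zero + (w p + w q)              ≡⟨ x+[y+z]≡y+[x+z] (c zero) (w p) (w q) ⟩
  w p + (c zero + w q)              ∎
  where open ≡-Reasoning
        w = weight (c ∘ suc)
weight-∪-∩ c (inside  ∷ p) (outside ∷ q) = begin
  (c zero + w (p ∪ q)) + w (p ∩ q)  ≡⟨ +-assoc (c zero) (w (p ∪ q)) (w (p ∩ q)) ⟩
  c zero + (w (p ∪ q) + w (p ∩ q))  ≡⟨ cong (c zero +_) (weight-∪-∩ (c ∘ suc) p q) ⟩
  c zero + (w p + w q)              ≡⟨ +-assoc (c zero) (w p) (w q) ⟨
  (c zero + w p) + w q              ∎
  where open ≡-Reasoning
        w = weight (c ∘ suc)
weight-∪-∩ c (inside  ∷ p) (inside  ∷ q) = begin
  (c zero + w (p ∪ q)) + (c zero + w (p ∩ q))  ≡⟨ +-interchange (c zero) (w (p ∪ q)) (c zero) (w (p ∩ q)) ⟩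
  (c zero + c zero) + (w (p ∪ q) + w (p ∩ q))  ≡⟨ cong ((c zero + c zero) +_) (weight-∪-∩ (c ∘ suc) p q) ⟩
  (c zero + c zero) + (w p + w q)              ≡⟨ +-interchange (c zero) (c zero) (w p) (w q) ⟩
  (c zero + w p) + (c zero + w q)              ∎
  where open ≡-Reasoning
        w = weight (c ∘ suc)

weight-mono : ∀ {n} {c c′ : Fin n → ℕ} → (∀ u → c u ≤ c′ u) → ∀ U → weight c U ≤ weight c′ U
weight-mono c≤c′ []            = z≤n
weight-mono c≤c′ (outside ∷ U) = weight-mono (c≤c′ ∘ suc) U
weight-mono c≤c′ (inside  ∷ U) = +-mono-≤ (c≤c′ zero) (weight-mono (c≤c′ ∘ suc) U)

weight-mono-< : ∀ {n} {c c′ : Fin n → ℕ} → (∀ u → c u ≤ c′ u) →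
                ∀ {U x} → x ∈ U → c x < c′ x → weight c U < weight c′ U
weight-mono-< c≤c′ {inside ∷ U} here      c<c′ = +-mono-<-≤ c<c′ (weight-mono (c≤c′ ∘ suc) U)
weight-mono-< c≤c′ {outside ∷ U} (there x∈U) c<c′ = weight-mono-< (c≤c′ ∘ suc) x∈U c<c′
weight-mono-< c≤c′ {inside  ∷ U} (there x∈U) c<c′ =
  +-mono-≤-< (c≤c′ zero) (weight-mono-< (c≤c′ ∘ suc) x∈U c<c′)

module _ {n} (F : Adj n) (G : Graph n) (U : Subset n) where

  ∈Nout⁺ : ∀ {u v} → u ∈ U → F u v ≡ true → v ∉ V G → v ∈ Nout F U G
  ∈Nout⁺ {u} {v} u∈U Fuv v∉G = ∈-tabulate⁺ (∧≡true⁺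
    (anyV⁺ (λ w → lookup U w ∧ F w v) u (∧≡true⁺ ([]=⇒lookup u∈U) Fuv))
    (cong not (∉⇒lookup≡false v∉G)))

  ∈Nout⁻ : ∀ {v} → v ∈ Nout F U G → (∃[ u ] (u ∈ U × F u v ≡ true)) × v ∉ V G
  ∈Nout⁻ {v} v∈N with ∧≡true⁻ (anyV (λ u → lookup U u ∧ F u v)) (∈-tabulate⁻ v∈N)
  ... | some , fresh with anyV⁻ _ some
  ...   | u , Uu∧Fuv with ∧≡true⁻ (lookup U u) Uu∧Fuv
  ...     | Uu , Fuv = (u , lookup⇒[]= u U Uu , Fuv) , lookup≡false⇒∉ (not-injective {y = false} fresh)

  ∈N⁻ : ∀ {v} → v ∈ N F U → ∃[ u ] (u ∈ U × F u v ≡ true)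
  ∈N⁻ {v} v∈N with anyV⁻ _ (∈-tabulate⁻ v∈N)
  ... | u , Uu∧Fuv with ∧≡true⁻ (lookup U u) Uu∧Fuv
  ...   | Uu , Fuv = u , lookup⇒[]= u U Uu , Fuv

  N⊆Nout∪V : N F U ⊆ Nout F U G ∪ V G
  N⊆Nout∪V {v} v∈N with lookup (V G) v in G[v]
  ... | true  = x∈p∪q⁺ (inj₂ (lookup⇒[]= v (V G) G[v]))
  ... | false with ∈N⁻ v∈N
  ...   | u , u∈U , Fuv = x∈p∪q⁺ (inj₁ (∈Nout⁺ u∈U Fuv (lookup≡false⇒∉ G[v])))

module _ {n} (F : Adj n) (G : Graph n) where

  Nout-mono : ∀ {p q} → p ⊆ q → Nout F p G ⊆ Nout F q G
  Nout-mono {q = q} p⊆q v∈N with ∈Nout⁻ F G _ v∈N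
  ... | (u , u∈p , Fuv) , v∉G = ∈Nout⁺ F G q (p⊆q u∈p) Fuv v∉G

  ∈Nout⁅⁆⁻ : ∀ {x y} → y ∈ Nout F ⁅ x ⁆ G → F x y ≡ true × y ∉ V G
  ∈Nout⁅⁆⁻ {x} y∈N with ∈Nout⁻ F G ⁅ x ⁆ y∈N
  ... | (u , u∈x , Fuy) , y∉G = subst (λ u → F u _ ≡ true) (x∈⁅y⁆⇒x≡y x u∈x) Fuy , y∉G

  Nout-∅ : Nout F ∅ G ⊆ ∅
  Nout-∅ v∈N with ∈Nout⁻ F G ∅ v∈N
  ... | (_ , u∈∅ , _) , _ = ⊥-elim (∉⊥ u∈∅)

  Nout-∪ : ∀ p q → Nout F (p ∪ q) G ⊆ Nout F p G ∪ Nout F q G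
  Nout-∪ p q v∈N with ∈Nout⁻ F G _ v∈N
  ... | (u , u∈p∪q , Fuv) , v∉G with x∈p∪q⁻ p q u∈p∪q
  ...   | inj₁ u∈p = x∈p∪q⁺ (inj₁ (∈Nout⁺ F G p u∈p Fuv v∉G))
  ...   | inj₂ u∈q = x∈p∪q⁺ (inj₂ (∈Nout⁺ F G q u∈q Fuv v∉G))

  Nout-∩ : ∀ p q → Nout F (p ∩ q) G ⊆ Nout F p G ∩ Nout F q G
  Nout-∩ p q v∈N = x∈p∩q⁺ (Nout-mono (p∩q⊆p p q) v∈N , Nout-mono (p∩q⊆q p q) v∈N)

  ∣Nout-∪∣+∣Nout-∩∣≤ : ∀ p q → ∣ Nout F (p ∪ q) G ∣ + ∣ Nout F (p ∩ q) G ∣ ≤ ∣ Nout F p G ∣ + ∣ Nout F q G ∣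
  ∣Nout-∪∣+∣Nout-∩∣≤ p q = begin
    ∣ Nout F (p ∪ q) G ∣ + ∣ Nout F (p ∩ q) G ∣
      ≤⟨ +-mono-≤ (p⊆q⇒∣p∣≤∣q∣ (Nout-∪ p q)) (p⊆q⇒∣p∣≤∣q∣ (Nout-∩ p q)) ⟩
    ∣ Nout F p G ∪ Nout F q G ∣ + ∣ Nout F p G ∩ Nout F q G ∣
      ≡⟨ ∣p∪q∣+∣p∩q∣≡∣p∣+∣q∣ (Nout F p G) (Nout F q G) ⟩
    ∣ Nout F p G ∣ + ∣ Nout F q G ∣ ∎
    where open ≤-Reasoning

  Nout-addEdge : ∀ U x y → Nout F U G ⊆ Nout F U (addEdge G x y) ∪ ⁅ y ⁆
  Nout-addEdge U x y {v} v∈N with v ≟ᶠ y | ∈Nout⁻ F G U v∈N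
  ... | yes refl | _                      = x∈p∪q⁺ (inj₂ (x∈⁅x⁆ y))
  ... | no v≢y   | (u , u∈U , Fuv) , v∉G = x∈p∪q⁺ (inj₁ (∈Nout⁺ F (addEdge G x y) U u∈U Fuv v∉G∪y))
    where v∉G∪y : v ∉ V G ∪ ⁅ y ⁆
          v∉G∪y v∈G∪y with x∈p∪q⁻ (V G) ⁅ y ⁆ v∈G∪y
          ... | inj₁ v∈G = v∉G v∈G
          ... | inj₂ v∈y = v≢y (x∈⁅y⁆⇒x≡y y v∈y)

  ∣Nout∣≤1+∣Nout-addEdge∣ : ∀ U x y → ∣ Nout F U G ∣ ≤ suc ∣ Nout F U (addEdge G x y) ∣
  ∣Nout∣≤1+∣Nout-addEdge∣ U x y = begin
    ∣ Nout F U G ∣                  ≤⟨ p⊆q⇒∣p∣≤∣q∣ (Nout-addEdge U x y) ⟩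
    ∣ Nout F U G′ ∪ ⁅ y ⁆ ∣         ≤⟨ ∣p∪q∣≤∣p∣+∣q∣ (Nout F U G′) ⁅ y ⁆ ⟩
    ∣ Nout F U G′ ∣ + ∣ ⁅ y ⁆ ∣     ≡⟨ cong (∣ Nout F U G′ ∣ +_) (∣⁅x⁆∣≡1 y) ⟩
    ∣ Nout F U G′ ∣ + 1             ≡⟨ +-comm (∣ Nout F U G′ ∣) 1 ⟩
    suc ∣ Nout F U G′ ∣             ∎
    where open ≤-Reasoning
          G′ = addEdge G x y

  Nout-addEdge-fresh : ∀ U x y → y ∉ Nout F U G → Nout F U G ⊆ Nout F U (addEdge G x y)
  Nout-addEdge-fresh U x y y∉N v∈N with x∈p∪q⁻ (Nout F U (addEdge G x y)) ⁅ y ⁆ (Nout-addEdge U x y v∈N)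
  ... | inj₁ v∈N′ = v∈N′
  ... | inj₂ v∈y  = ⊥-elim (y∉N (subst (_∈ Nout F U G) (x∈⁅y⁆⇒x≡y y v∈y) v∈N))

degInto : ∀ {n} → Adj n → Subset n → Fin n → ℕ
degInto F B u = ∣ tabulate (λ v → F u v ∧ lookup B v) ∣

degInto-Sᵢ≤deg : ∀ {n} (G : Graph n) X j B u → degInto (Sᵢ G X j) B u ≤ deg G u
degInto-Sᵢ≤deg G X j B u = p⊆q⇒∣p∣≤∣q∣ (tabulate-⊆ λ v s →
  proj₁ (∧≡true⁻ (E G u v) (proj₁ (∧≡true⁻ (Sᵢ G X j u v) s))))

module _ {n} {F F′ : Adj n} (B : Subset n) (u : Fin n) (F⇒F′ : ∀ v → F u v ≡ true → F′ u v ≡ true) where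

  private
    neighbours-⊆ : tabulate (λ v → F u v ∧ lookup B v) ⊆ tabulate (λ v → F′ u v ∧ lookup B v)
    neighbours-⊆ = tabulate-⊆ λ v Fuv∧Bv → let Fuv , Bv = ∧≡true⁻ (F u v) Fuv∧Bv in ∧≡true⁺ (F⇒F′ v Fuv) Bv

  degInto-mono : degInto F B u ≤ degInto F′ B u
  degInto-mono = p⊆q⇒∣p∣≤∣q∣ neighbours-⊆

  degInto-mono-< : ∀ {y} → y ∈ B → F u y ≡ false → F′ u y ≡ true → degInto F B u < degInto F′ B u
  degInto-mono-< {y} y∈B ¬Fuy F′uy = p⊂q⇒∣p∣<∣q∣
    ( neighbours-⊆
    , y , ∈-tabulate⁺ (∧≡true⁺ F′uy ([]=⇒lookup y∈B))
    , λ y∈ → not-¬ (proj₁ (∧≡true⁻ (F u y) (∈-tabulate⁻ y∈))) ¬Fuy )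

module _ {n} (cls : Fin n → Fin 2) (H : Fin 2 → Adj n) (X : Subset n) where

  cost : Fin 2 → Graph n → Subset n → ℕ
  cost j G U = ∣ Nout (H j) U G ∣ + eS cls G X j U

  cost-∅ : ∀ j G → cost j G ∅ ≡ 0
  cost-∅ j G = cong₂ _+_ (n≤0⇒n≡0 (≤-trans (p⊆q⇒∣p∣≤∣q∣ (Nout-∅ (H j) G)) (≤-reflexive (∣⊥∣≡0 n))))
                         (weight-∅ (degInto (Sᵢ G X j) (class cls (other j))))

  cost-submodular : ∀ j G p q → cost j G (p ∪ q) + cost j G (p ∩ q) ≤ cost j G p + cost j G q
  cost-submodular j G p q = begin
    (out (p ∪ q) + e (p ∪ q)) + (out (p ∩ q) + e (p ∩ q))
      ≡⟨ +-interchange (out (p ∪ q)) (e (p ∪ q)) (out (p ∩ q)) (e (p ∩ q)) ⟩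
    (out (p ∪ q) + out (p ∩ q)) + (e (p ∪ q) + e (p ∩ q))
      ≤⟨ +-mono-≤ (∣Nout-∪∣+∣Nout-∩∣≤ (H j) G p q)
                  (≤-reflexive (weight-∪-∩ (degInto (Sᵢ G X j) (class cls (other j))) p q)) ⟩
    (out p + out q) + (e p + e q)
      ≡⟨ +-interchange (out p) (out q) (e p) (e q) ⟩
    (out p + e p) + (out q + e q) ∎
    where open ≤-Reasoning
          out e : Subset n → ℕ
          out U = ∣ Nout (H j) U G ∣
          e = eS cls G X j

-- Distances to the roots

search-least : ∀ (f : ℕ → Bool) b k → k < b → f k ≡ true →
               f (search f b) ≡ true × (∀ j → j < search f b → f j ≡ false)
search-least f (suc b) k k<b fk with f zero in f0
... | true = f0 , λ _ ()
search-least f (suc b) zero    _         fk | false with () ← trans (sym fk) f0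
search-least f (suc b) (suc k) (s≤s k<b) fk | false with search-least (f ∘ suc) b k k<b fk
... | found , below = found , λ { zero _ → f0 ; (suc j) (s≤s j<s) → below j j<s }

search-cong : ∀ {f g : ℕ → Bool} b → (∀ k → f k ≡ g k) → search f b ≡ search g b
search-cong zero    _ = refl
search-cong {f} {g} (suc b) e rewrite e zero =
  cong (λ s → if g zero then zero else suc s) (search-cong b (e ∘ suc))

module Reachability {n} (S : Graph n) (X : Subset n) where

  reach-suc : ∀ k {v} → reach S X k v ≡ true → reach S X (suc k) v ≡ true
  reach-suc k = ∨≡true⁺ˡ _

  reach-step : ∀ k {v w} → E S v w ≡ true → reach S X k w ≡ true → reach S X (suc k) v ≡ true
  reach-step k {v} {w} vw r =
    ∨≡true⁺ʳ (reach S X k v) (anyV⁺ (λ w → E S v w ∧ reach S X k w) w (∧≡true⁺ vw r))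

  reach-+ : ∀ j k {v} → reach S X k v ≡ true → reach S X (j + k) v ≡ true
  reach-+ zero    k r = r
  reach-+ (suc j) k r = reach-suc (j + k) (reach-+ j k r)

  walk⇒reach : ∀ {u w L} → Walk S u w L → w ∈ X → reach S X L u ≡ true
  walk⇒reach (here _)               w∈X = []=⇒lookup w∈X
  walk⇒reach {L = suc L} (step e p) w∈X = reach-step L e (walk⇒reach p w∈X)

  Stable : ℕ → Set
  Stable k = ∀ v → reach S X (suc k) v ≡ reach S X k v

  reach-stable : ∀ k → Stable k → ∀ j v → reach S X (j + k) v ≡ reach S X k v
  reach-stable k st zero    v = refl
  reach-stable k st (suc j) v =
    trans (cong₂ _∨_ (reach-stable k st j v) (anyV-cong (λ w → cong (E S v w ∧_) (reach-stable k st j w))))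
          (st v)

  stable-suc : ∀ k → Stable k → Stable (suc k)
  stable-suc k st v = trans (reach-stable k st 2 v) (sym (reach-stable k st 1 v))

  reach-grows : ∀ {w} → w ∈ X → ∀ k → suc k ≤ ∣ tabulate (reach S X k) ∣ ⊎ Stable k
  reach-grows {w} w∈X zero = inj₁ (begin
    1                     ≡⟨ ∣⁅x⁆∣≡1 w ⟨
    ∣ ⁅ w ⁆ ∣             ≤⟨ p⊆q⇒∣p∣≤∣q∣ (λ v∈w →
                               ∈-tabulate⁺ ([]=⇒lookup (subst (_∈ X) (sym (x∈⁅y⁆⇒x≡y w v∈w)) w∈X))) ⟩
    ∣ tabulate (lookup X) ∣ ∎)
    where open ≤-Reasoning
  reach-grows w∈X (suc k) with reach-grows w∈X k
  ... | inj₂ st = inj₂ (stable-suc k st)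
  ... | inj₁ grown with any? (λ v → (reach S X (suc k) v ≟ᵇ true) ×-dec (reach S X k v ≟ᵇ false))
  ...   | yes (v , new , old) = inj₁ (≤-trans (s≤s grown) (p⊂q⇒∣p∣<∣q∣ strict))
    where strict : tabulate (reach S X k) ⊂ tabulate (reach S X (suc k))
          strict = tabulate-⊆ (λ _ → reach-suc k) , v , ∈-tabulate⁺ new , λ v∈ → not-¬ (∈-tabulate⁻ v∈) old
  ...   | no none = inj₂ (stable-suc k st)
    where st : Stable k
          st v = ∨-redundantʳ (reach S X k v) λ b →
            ¬-not (λ old → none (v , ∨≡true⁺ʳ (reach S X k v) b , old))

-- dist and distToX only search below the number of vertices, so a reachable root must be
-- reached in fewer steps: the reached sets grow strictly until they stabilise.
reach-saturates : ∀ {n} (S : Graph (suc n)) (X : Subset (suc n)) {u w L} →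
                  Walk S u w L → w ∈ X → reach S X n u ≡ true
reach-saturates {n} S X {u} {L = L} walk w∈X = saturate (reach-grows w∈X n)
  where
  open Reachability S X
  saturate : suc n ≤ ∣ tabulate (reach S X n) ∣ ⊎ Stable n → reach S X n u ≡ true
  saturate (inj₁ full) = ∈-tabulate⁻ {f = reach S X n}
    (subst (u ∈_) (sym (∣p∣≡n⇒p≡⊤ (≤-antisym (∣p∣≤n (tabulate (reach S X n))) full))) ∈⊤)
  saturate (inj₂ st)   = trans (sym (reach-stable n st L u))
    (subst (λ k → reach S X k u ≡ true) (+-comm n L) (reach-+ n L (walk⇒reach walk w∈X)))

distToX : ∀ {n} → Graph n → Subset n → Fin n → ℕ
distToX {n} S X v = search (λ k → reach S X k v) n

module _ {n} (S : Graph n) (X : Subset n) (cls : Fin n → Fin 2)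
         (X⊆A₁ : X ⊆ class cls zero) (crossing : ∀ {u v} → E S u v ≡ true → cls u ≢ cls v) where

  open Reachability S X

  reach-parity : ∀ k {v} → reach S X k v ≡ true → (∀ j → j < k → reach S X j v ≡ false) → cls v ≡ parity k
  reach-parity zero    r _ = ∈-class⁻ (X⊆A₁ (lookup⇒[]= _ X r))
  reach-parity (suc k) {v} r earlier with ∨≡true⁻ (reach S X k v) r
  ... | inj₁ rk = ⊥-elim (not-¬ rk (earlier k ≤-refl))
  ... | inj₂ rw with anyV⁻ _ rw
  ...   | w , vw∧rw with ∧≡true⁻ (E S v w) vw∧rw
  ...     | vw , rkw = begin
    cls v              ≡⟨ ≢⇒≡other (crossing vw ∘ sym) ⟩
    other (cls w)      ≡⟨ cong other (reach-parity k rkw earlier-w) ⟩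
    other (parity k)   ≡⟨ parity-suc k ⟨
    parity (suc k)     ∎
    where open ≡-Reasoning
          earlier-w : ∀ j → j < k → reach S X j w ≡ false
          earlier-w j j<k = ¬-not (λ rjw → not-¬ (reach-step j vw rjw) (earlier (suc j) (s≤s j<k)))

distToX-parity : ∀ {n} (S : Graph n) (X : Subset n) (cls : Fin n → Fin 2) →
                 X ⊆ class cls zero → (∀ {u v} → E S u v ≡ true → cls u ≢ cls v) →
                 ∀ {v w L} → Walk S v w L → w ∈ X → cls v ≡ parity (distToX S X v)
distToX-parity {suc n} S X cls X⊆A₁ crossing {v} walk w∈X
  with search-least (λ k → reach S X k v) (suc n) n ≤-refl (reach-saturates S X walk w∈X)
... | found , least = reach-parity S X cls X⊆A₁ crossing _ found least

-- Adding a pendant edge at a fresh vertex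

module FreshLeaf {n} (S : Graph n) (X : Subset n) (x y : Fin n) (x≢y : x ≢ y) (y∉X : y ∉ X)
                 (no-edge-from-y : ∀ w → E S y w ≡ false) (no-edge-to-y : ∀ w → E S w y ≡ false) where

  S′ : Graph n
  S′ = addEdge S x y

  open Reachability

  parityₓ : Fin 2
  parityₓ = parity (distToX S X x)

  E-addEdge⁺ : ∀ {u v} → E S u v ≡ true → E S′ u v ≡ true
  E-addEdge⁺ = ∨≡true⁺ˡ _

  E-addEdge-xy : E S′ x y ≡ true
  E-addEdge-xy = ∨≡true⁺ʳ (E S x y) (∨≡true⁺ˡ _ (∧≡true⁺ (⌊⌋≡true⁺ (x ≟ᶠ x) refl) (⌊⌋≡true⁺ (y ≟ᶠ y) refl)))

  E-addEdge⁻ : ∀ {u v} → E S′ u v ≡ true → E S u v ≡ true ⊎ ((u ≡ x × v ≡ y) ⊎ (u ≡ y × v ≡ x))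
  E-addEdge⁻ {u} {v} e with ∨≡true⁻ (E S u v) e
  ... | inj₁ old = inj₁ old
  ... | inj₂ new with ∨≡true⁻ (⌊ u ≟ᶠ x ⌋ ∧ ⌊ v ≟ᶠ y ⌋) new
  ...   | inj₁ xy with ∧≡true⁻ ⌊ u ≟ᶠ x ⌋ xy
  ...     | u≡x , v≡y = inj₂ (inj₁ (⌊⌋≡true⁻ (u ≟ᶠ x) u≡x , ⌊⌋≡true⁻ (v ≟ᶠ y) v≡y))
  E-addEdge⁻ {u} {v} e | inj₂ new | inj₂ yx with ∧≡true⁻ ⌊ u ≟ᶠ y ⌋ yx
  ...     | u≡y , v≡x = inj₂ (inj₂ (⌊⌋≡true⁻ (u ≟ᶠ y) u≡y , ⌊⌋≡true⁻ (v ≟ᶠ x) v≡x))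

  source≢y : ∀ {u v} → E S u v ≡ true → u ≢ y
  source≢y {v = v} e refl = not-¬ e (no-edge-from-y v)

  target≢y : ∀ {u v} → E S u v ≡ true → v ≢ y
  target≢y {u} e refl = not-¬ e (no-edge-to-y u)

  reach-addEdge : ∀ k → (∀ v → v ≢ y → reach S′ X k v ≡ reach S X k v) ×
                        (reach S′ X k y ≡ true → reach S X k x ≡ true)
  reach-addEdge zero    = (λ _ _ → refl) , λ r → ⊥-elim (y∉X (lookup⇒[]= y X r))
  reach-addEdge (suc k) = unchanged , y-via-x
    where
    same-k : ∀ v → v ≢ y → reach S′ X k v ≡ reach S X k v
    same-k = proj₁ (reach-addEdge k)
    via-k : reach S′ X k y ≡ true → reach S X k x ≡ true
    via-k = proj₂ (reach-addEdge k)

    unchanged : ∀ v → v ≢ y → reach S′ X (suc k) v ≡ reach S X (suc k) v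
    unchanged v v≢y = Bool-ext to from
      where
      to : reach S′ X (suc k) v ≡ true → reach S X (suc k) v ≡ true
      to r with ∨≡true⁻ (reach S′ X k v) r
      ... | inj₁ rv = reach-suc S X k (trans (sym (same-k v v≢y)) rv)
      ... | inj₂ rw with anyV⁻ _ rw
      ...   | w , vw∧rw with ∧≡true⁻ (E S′ v w) vw∧rw
      ...     | vw , rkw with E-addEdge⁻ vw
      ...       | inj₁ old               = reach-step S X k old (trans (sym (same-k w (target≢y old))) rkw)
      ...       | inj₂ (inj₁ (refl , refl)) = reach-suc S X k (via-k rkw)
      ...       | inj₂ (inj₂ (v≡y , _))     = ⊥-elim (v≢y v≡y)
      from : reach S X (suc k) v ≡ true → reach S′ X (suc k) v ≡ true
      from r with ∨≡true⁻ (reach S X k v) r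
      ... | inj₁ rv = reach-suc S′ X k (trans (same-k v v≢y) rv)
      ... | inj₂ rw with anyV⁻ _ rw
      ...   | w , vw∧rw with ∧≡true⁻ (E S v w) vw∧rw
      ...     | vw , rkw = reach-step S′ X k (E-addEdge⁺ vw) (trans (same-k w (target≢y vw)) rkw)

    y-via-x : reach S′ X (suc k) y ≡ true → reach S X (suc k) x ≡ true
    y-via-x r with ∨≡true⁻ (reach S′ X k y) r
    ... | inj₁ ry = reach-suc S X k (via-k ry)
    ... | inj₂ rw with anyV⁻ _ rw
    ...   | w , yw∧rw with ∧≡true⁻ (E S′ y w) yw∧rw
    ...     | yw , rkw with E-addEdge⁻ yw
    ...       | inj₁ old                  = ⊥-elim (source≢y old refl)
    ...       | inj₂ (inj₁ (y≡x , _))     = ⊥-elim (x≢y (sym y≡x))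
    ...       | inj₂ (inj₂ (_ , refl))    = reach-suc S X k (trans (sym (same-k x x≢y)) rkw)

  dist-addEdge : ∀ {u v} → u ≢ y → v ≢ y → dist S′ X u v ≡ dist S X u v
  dist-addEdge {u} {v} u≢y v≢y =
    search-cong n (λ k → cong₂ _∨_ (proj₁ (reach-addEdge k) u u≢y) (proj₁ (reach-addEdge k) v v≢y))

  reach-addEdge-xy : ∀ k → reach S′ X k x ∨ reach S′ X k y ≡ reach S X k x
  reach-addEdge-xy k = Bool-ext to (∨≡true⁺ˡ _ ∘ trans (proj₁ (reach-addEdge k) x x≢y))
    where to : reach S′ X k x ∨ reach S′ X k y ≡ true → reach S X k x ≡ true
          to r with ∨≡true⁻ (reach S′ X k x) r
          ... | inj₁ rx = trans (sym (proj₁ (reach-addEdge k) x x≢y)) rx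
          ... | inj₂ ry = proj₂ (reach-addEdge k) ry

  dist-addEdge-xy : dist S′ X x y ≡ distToX S X x
  dist-addEdge-xy = search-cong n reach-addEdge-xy

  dist-addEdge-yx : dist S′ X y x ≡ distToX S X x
  dist-addEdge-yx = search-cong n (λ k → trans (∨-comm (reach S′ X k y) _) (reach-addEdge-xy k))

  Sᵢ-addEdge⁺ : ∀ {j u v} → Sᵢ S X j u v ≡ true → Sᵢ S′ X j u v ≡ true
  Sᵢ-addEdge⁺ {j} {u} {v} s with ∧≡true⁻ (E S u v) s
  ... | uv , ok = ∧≡true⁺ (E-addEdge⁺ uv)
    (subst (λ k → parityOk k j ≡ true) (sym (dist-addEdge (source≢y uv) (target≢y uv))) ok)

  Sᵢ-addEdge-xy : Sᵢ S′ X parityₓ x y ≡ true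
  Sᵢ-addEdge-xy = ∧≡true⁺ E-addEdge-xy
    (subst (λ k → parityOk k parityₓ ≡ true) (sym dist-addEdge-xy) (parityOk-parity (distToX S X x)))

  ≡parityₓ : ∀ {k j} → k ≡ distToX S X x → parityOk k j ≡ true → j ≡ parityₓ
  ≡parityₓ refl = parityOk⇒≡parity (distToX S X x)

  Sᵢ-addEdge⁻ : ∀ {j u v} → Sᵢ S′ X j u v ≡ true →
                Sᵢ S X j u v ≡ true ⊎ (j ≡ parityₓ × ((u ≡ x × v ≡ y) ⊎ (u ≡ y × v ≡ x)))
  Sᵢ-addEdge⁻ {j} {u} {v} s with ∧≡true⁻ (E S′ u v) s
  ... | uv , ok with E-addEdge⁻ uv
  ...   | inj₁ old = inj₁ (∧≡true⁺ old
          (subst (λ k → parityOk k j ≡ true) (dist-addEdge (source≢y old) (target≢y old)) ok))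
  ...   | inj₂ (inj₁ (refl , refl)) = inj₂ (≡parityₓ dist-addEdge-xy ok , inj₁ (refl , refl))
  ...   | inj₂ (inj₂ (refl , refl)) = inj₂ (≡parityₓ dist-addEdge-yx ok , inj₂ (refl , refl))

  deg-addEdge-x : deg S′ x ≤ suc (deg S x)
  deg-addEdge-x = begin
    ∣ tabulate (E S′ x) ∣             ≤⟨ p⊆q⇒∣p∣≤∣q∣ old-or-y ⟩
    ∣ tabulate (E S x) ∪ ⁅ y ⁆ ∣      ≤⟨ ∣p∪q∣≤∣p∣+∣q∣ (tabulate (E S x)) ⁅ y ⁆ ⟩
    deg S x + ∣ ⁅ y ⁆ ∣                ≡⟨ cong (deg S x +_) (∣⁅x⁆∣≡1 y) ⟩
    deg S x + 1                        ≡⟨ +-comm (deg S x) 1 ⟩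
    suc (deg S x)                      ∎
    where
    open ≤-Reasoning
    old-or-y : tabulate (E S′ x) ⊆ tabulate (E S x) ∪ ⁅ y ⁆
    old-or-y v∈ with E-addEdge⁻ (∈-tabulate⁻ v∈)
    ... | inj₁ old                = x∈p∪q⁺ (inj₁ (∈-tabulate⁺ old))
    ... | inj₂ (inj₁ (_ , refl))  = x∈p∪q⁺ (inj₂ (x∈⁅x⁆ y))
    ... | inj₂ (inj₂ (x≡y , _))   = ⊥-elim (x≢y x≡y)

  deg-addEdge-y : deg S′ y ≤ 1
  deg-addEdge-y = ≤-trans (p⊆q⇒∣p∣≤∣q∣ only-x) (≤-reflexive (∣⁅x⁆∣≡1 x))
    where
    only-x : tabulate (E S′ y) ⊆ ⁅ x ⁆
    only-x v∈ with E-addEdge⁻ (∈-tabulate⁻ v∈)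
    ... | inj₁ old                = ⊥-elim (source≢y old refl)
    ... | inj₂ (inj₁ (y≡x , _))   = ⊥-elim (x≢y (sym y≡x))
    ... | inj₂ (inj₂ (_ , refl))  = x∈⁅x⁆ x

  deg-addEdge : ∀ {v} → v ≢ x → v ≢ y → deg S′ v ≤ deg S v
  deg-addEdge v≢x v≢y = p⊆q⇒∣p∣≤∣q∣ old
    where
    old : tabulate (E S′ _) ⊆ tabulate (E S _)
    old w∈ with E-addEdge⁻ (∈-tabulate⁻ w∈)
    ... | inj₁ vw                 = ∈-tabulate⁺ vw
    ... | inj₂ (inj₁ (v≡x , _))   = ⊥-elim (v≢x v≡x)
    ... | inj₂ (inj₂ (v≡y , _))   = ⊥-elim (v≢y v≡y)

  degInto-addEdge : ∀ j B u → degInto (Sᵢ S X j) B u ≤ degInto (Sᵢ S′ X j) B u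
  degInto-addEdge j B u = degInto-mono {F = Sᵢ S X j} {F′ = Sᵢ S′ X j} B u (λ _ → Sᵢ-addEdge⁺)

  degInto-addEdge-x : ∀ B → y ∈ B → degInto (Sᵢ S X parityₓ) B x < degInto (Sᵢ S′ X parityₓ) B x
  degInto-addEdge-x B y∈B =
    degInto-mono-< {F = Sᵢ S X parityₓ} {F′ = Sᵢ S′ X parityₓ} B x (λ _ → Sᵢ-addEdge⁺) y∈B
    (¬-not (λ s → not-¬ (proj₁ (∧≡true⁻ (E S x y) s)) (no-edge-to-y x))) Sᵢ-addEdge-xy

-- Tight sets

module TightSets {n d m} {cls : Fin n → Fin 2} {H : Fin 2 → Adj n} {S : Graph n} {X : Subset n}
                 (ext : Extendable cls H S X d m) (i : Fin 2) (x : Fin n) where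

  open Extendable ext

  expansion : ∀ {j U} → U ⊆ class cls j → ∣ U ∣ ≤ 2 * m → d * ∣ U ∣ ≤ cost cls H X j S U
  expansion {j} {U} U⊆Aⱼ small with ∣ U ∣ ≟ 0
  ... | yes empty rewrite empty | *-zeroʳ d = z≤n
  ... | no nonempty = expand j U U⊆Aⱼ (n≢0⇒n>0 nonempty) small

  record Tight (T : Subset n) : Set where
    constructor mkTight
    field
      ⊆Aᵢ   : T ⊆ class cls i
      x∉    : x ∉ T
      small : ∣ T ∣ ≤ 2 * m
      tight : cost cls H X i S T ≤ d * ∣ T ∣

  tight? : ∀ T → Dec (Tight T)
  tight? T = map′ (λ { (a , b , c , e) → mkTight a b c e })
                  (λ { (mkTight a b c e) → (λ {v} → a {v}) , b , c , e })
    ((T ⊆? class cls i) ×-dec ¬? (x ∈? T) ×-dec (∣ T ∣ ≤? 2 * m) ×-dec (cost cls H X i S T ≤? d * ∣ T ∣))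

  tight-∅ : Tight ∅
  tight-∅ = mkTight (⊥-elim ∘ ∉⊥) ∉⊥ (≤-trans (≤-reflexive (∣⊥∣≡0 n)) z≤n)
                    (≤-trans (≤-reflexive (cost-∅ cls H X i S)) z≤n)

  Covered : Fin n → Set
  Covered y = ∃[ T ] (Tight T × y ∈ Nout (H i) T S)

  covered? : ∀ y → Dec (Covered y)
  covered? y = anySubset? (λ T → tight? T ×-dec (y ∈? Nout (H i) T S))

  cost-∪-⁅x⁆ : ∀ {P} → Nout (H i) ⁅ x ⁆ S ⊆ Nout (H i) P S →
               cost cls H X i S (P ∪ ⁅ x ⁆) ≤ cost cls H X i S P + deg S x
  cost-∪-⁅x⁆ {P} covers = begin
    ∣ Nout (H i) (P ∪ ⁅ x ⁆) S ∣ + weight c (P ∪ ⁅ x ⁆)  ≤⟨ +-mono-≤ (p⊆q⇒∣p∣≤∣q∣ Nout⊆) weight≤ ⟩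
    ∣ Nout (H i) P S ∣ + (weight c P + deg S x)           ≡⟨ +-assoc _ (weight c P) (deg S x) ⟨
    cost cls H X i S P + deg S x                          ∎
    where
    open ≤-Reasoning
    Aₒ : Subset n
    Aₒ = class cls (other i)
    c : Fin n → ℕ
    c = degInto (Sᵢ S X i) Aₒ
    Nout⊆ : Nout (H i) (P ∪ ⁅ x ⁆) S ⊆ Nout (H i) P S
    Nout⊆ v∈ with x∈p∪q⁻ (Nout (H i) P S) (Nout (H i) ⁅ x ⁆ S) (Nout-∪ (H i) S P ⁅ x ⁆ v∈)
    ... | inj₁ v∈P = v∈P
    ... | inj₂ v∈x = covers v∈x
    weight≤ : weight c (P ∪ ⁅ x ⁆) ≤ weight c P + deg S x
    weight≤ = begin
      weight c (P ∪ ⁅ x ⁆)                       ≤⟨ m≤m+n (weight c (P ∪ ⁅ x ⁆)) (weight c (P ∩ ⁅ x ⁆)) ⟩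
      weight c (P ∪ ⁅ x ⁆) + weight c (P ∩ ⁅ x ⁆) ≡⟨ weight-∪-∩ c P ⁅ x ⁆ ⟩
      weight c P + weight c ⁅ x ⁆                 ≡⟨ cong (weight c P +_) (weight-⁅⁆ c x) ⟩
      weight c P + c x                            ≤⟨ +-monoʳ-≤ (weight c P) (degInto-Sᵢ≤deg S X i Aₒ x) ⟩
      weight c P + deg S x                        ∎

  module _ (room : 2 * ∣ V S ∣ + 4 * d * m < ∣ class cls (other i) ∣) where

    tight⇒small : ∀ {T} → Tight T → ∣ T ∣ < m
    tight⇒small {T} (mkTight T⊆Aᵢ _ T-small T-tight) with m ≤? ∣ T ∣
    ... | no  m≰T = ≰⇒> m≰T
    ... | yes m≤T = ⊥-elim (<-irrefl refl (<-≤-trans room (begin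
      ∣ class cls (other i) ∣                ≤⟨ large i T T⊆Aᵢ m≤T ⟩
      2 * ∣ N (H i) T ∣                       ≤⟨ *-monoʳ-≤ 2 (p⊆q⇒∣p∣≤∣q∣ (N⊆Nout∪V (H i) S T)) ⟩
      2 * ∣ Nout (H i) T S ∪ V S ∣           ≤⟨ *-monoʳ-≤ 2 (∣p∪q∣≤∣p∣+∣q∣ (Nout (H i) T S) (V S)) ⟩
      2 * (∣ Nout (H i) T S ∣ + ∣ V S ∣)     ≤⟨ *-monoʳ-≤ 2 (+-monoˡ-≤ (∣ V S ∣) out≤) ⟩
      2 * (d * (2 * m) + ∣ V S ∣)            ≡⟨ rearrange (∣ V S ∣) d m ⟩
      2 * ∣ V S ∣ + 4 * d * m                ∎)))
      where
      open ≤-Reasoning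
      out≤ : ∣ Nout (H i) T S ∣ ≤ d * (2 * m)
      out≤ = ≤-trans (m≤m+n _ _) (≤-trans T-tight (*-monoʳ-≤ d T-small))
      rearrange : ∀ v d m → 2 * (d * (2 * m) + v) ≡ 2 * v + 4 * d * m
      rearrange = solve-∀

    tight-∪ : ∀ {p q} → Tight p → Tight q → Tight (p ∪ q)
    tight-∪ {p} {q} tp@(mkTight p⊆Aᵢ x∉p _ p-tight) tq@(mkTight q⊆Aᵢ x∉q _ q-tight) =
      mkTight p∪q⊆Aᵢ (x∉p∪q ∘ x∈p∪q⁻ p q) p∪q-small p∪q-tight
      where
      open ≤-Reasoning
      costᵢ : Subset n → ℕ
      costᵢ = cost cls H X i S
      p∪q⊆Aᵢ : p ∪ q ⊆ class cls i
      p∪q⊆Aᵢ v∈ with x∈p∪q⁻ p q v∈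
      ... | inj₁ v∈p = p⊆Aᵢ v∈p
      ... | inj₂ v∈q = q⊆Aᵢ v∈q
      x∉p∪q : ¬ (x ∈ p ⊎ x ∈ q)
      x∉p∪q (inj₁ x∈p) = x∉p x∈p
      x∉p∪q (inj₂ x∈q) = x∉q x∈q
      p∪q-small : ∣ p ∪ q ∣ ≤ 2 * m
      p∪q-small = begin
        ∣ p ∪ q ∣      ≤⟨ ∣p∪q∣≤∣p∣+∣q∣ p q ⟩
        ∣ p ∣ + ∣ q ∣  ≤⟨ +-mono-≤ (<⇒≤ (tight⇒small tp)) (<⇒≤ (tight⇒small tq)) ⟩
        m + m          ≡⟨ cong (m +_) (+-identityʳ m) ⟨
        2 * m          ∎
      p∪q-tight : costᵢ (p ∪ q) ≤ d * ∣ p ∪ q ∣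
      p∪q-tight = +-cancelʳ-≤ (d * ∣ p ∩ q ∣) (costᵢ (p ∪ q)) (d * ∣ p ∪ q ∣) (begin
        costᵢ (p ∪ q) + d * ∣ p ∩ q ∣      ≤⟨ +-monoʳ-≤ (costᵢ (p ∪ q)) (expansion (p⊆Aᵢ ∘ p∩q⊆p p q)
                                                 (≤-trans (p⊆q⇒∣p∣≤∣q∣ (p⊆p∪q q ∘ p∩q⊆p p q)) p∪q-small)) ⟩
        costᵢ (p ∪ q) + costᵢ (p ∩ q)      ≤⟨ cost-submodular cls H X i S p q ⟩
        costᵢ p + costᵢ q                  ≤⟨ +-mono-≤ p-tight q-tight ⟩
        d * ∣ p ∣ + d * ∣ q ∣              ≡⟨ *-distribˡ-+ d (∣ p ∣) (∣ q ∣) ⟨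
        d * (∣ p ∣ + ∣ q ∣)                ≡⟨ cong (d *_) (∣p∪q∣+∣p∩q∣≡∣p∣+∣q∣ p q) ⟨
        d * (∣ p ∪ q ∣ + ∣ p ∩ q ∣)        ≡⟨ *-distribˡ-+ d (∣ p ∪ q ∣) (∣ p ∩ q ∣) ⟩
        d * ∣ p ∪ q ∣ + d * ∣ p ∩ q ∣      ∎)

    tight-cover : ∀ (ys : List (Fin n)) → (∀ {y} → y ∈ₗ ys → Covered y) →
                  ∃[ P ] (Tight P × (∀ {y} → y ∈ₗ ys → y ∈ Nout (H i) P S))
    tight-cover []       _   = ∅ , tight-∅ , λ ()
    tight-cover (y ∷ ys) cov with cov (hereₗ refl) | tight-cover ys (cov ∘ thereₗ)
    ... | T , T-tight , y∈T | P , P-tight , P-covers = T ∪ P , tight-∪ T-tight P-tight , λ where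
      (hereₗ refl) → Nout-mono (H i) S (p⊆p∪q {p = T} P) y∈T
      (thereₗ z∈)  → Nout-mono (H i) S (q⊆p∪q T P) (P-covers z∈)

    tight-cover-neighbours : (∀ {y} → y ∈ Nout (H i) ⁅ x ⁆ S → Covered y) →
                             ∃[ P ] (Tight P × Nout (H i) ⁅ x ⁆ S ⊆ Nout (H i) P S)
    tight-cover-neighbours all-covered =
      let P , P-tight , covers = tight-cover (filter candidate? (allFin n))
                                   (all-covered ∘ proj₂ ∘ ∈-filter⁻ candidate? {xs = allFin n})
      in P , P-tight , covers ∘ ∈-filter⁺ candidate? (∈-allFin _)
      where candidate? = _∈? Nout (H i) ⁅ x ⁆ S

    neighbours-not-all-covered : cls x ≡ i → deg S x < d → ¬ (∀ {y} → y ∈ Nout (H i) ⁅ x ⁆ S → Covered y)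
    neighbours-not-all-covered clsx deg<d all-covered with tight-cover-neighbours all-covered
    ... | P , P-tight@(mkTight P⊆Aᵢ x∉P _ P-cost) , covers = <-irrefl refl (begin-strict
      d * suc ∣ P ∣                  ≡⟨ cong (d *_) (∣p∪⁅x⁆∣≡1+∣p∣ x∉P) ⟨
      d * ∣ P ∪ ⁅ x ⁆ ∣              ≤⟨ expansion P∪x⊆Aᵢ P∪x-small ⟩
      cost cls H X i S (P ∪ ⁅ x ⁆)   ≤⟨ cost-∪-⁅x⁆ {P} covers ⟩
      cost cls H X i S P + deg S x   ≤⟨ +-monoˡ-≤ (deg S x) P-cost ⟩
      d * ∣ P ∣ + deg S x            <⟨ +-monoʳ-< (d * ∣ P ∣) deg<d ⟩
      d * ∣ P ∣ + d                  ≡⟨ +-comm (d * ∣ P ∣) d ⟩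
      d + d * ∣ P ∣                  ≡⟨ *-suc d (∣ P ∣) ⟨
      d * suc ∣ P ∣                  ∎)
      where
      open ≤-Reasoning
      P∪x⊆Aᵢ : P ∪ ⁅ x ⁆ ⊆ class cls i
      P∪x⊆Aᵢ v∈ with x∈p∪q⁻ P ⁅ x ⁆ v∈
      ... | inj₁ v∈P = P⊆Aᵢ v∈P
      ... | inj₂ v∈x = ∈-class⁺ (trans (cong cls (x∈⁅y⁆⇒x≡y x v∈x)) clsx)
      P∪x-small : ∣ P ∪ ⁅ x ⁆ ∣ ≤ 2 * m
      P∪x-small = begin
        ∣ P ∪ ⁅ x ⁆ ∣   ≡⟨ ∣p∪⁅x⁆∣≡1+∣p∣ x∉P ⟩
        suc ∣ P ∣       ≤⟨ tight⇒small P-tight ⟩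
        m               ≤⟨ m≤m+n m (m + 0) ⟩
        2 * m           ∎

    uncovered-neighbour : cls x ≡ i → deg S x < d → ∃[ y ] (y ∈ Nout (H i) ⁅ x ⁆ S × ¬ Covered y)
    uncovered-neighbour clsx deg<d with any? (λ y → (y ∈? Nout (H i) ⁅ x ⁆ S) ×-dec ¬? (covered? y))
    ... | yes found = found
    ... | no  none  = ⊥-elim (neighbours-not-all-covered clsx deg<d λ {y} y∈ →
                        decidable-stable (covered? y) (λ ¬cov → none (y , y∈ , ¬cov)))

module AddLeaf {n d m} {cls : Fin n → Fin 2} {H : Fin 2 → Adj n} {S : Graph n} {X : Subset n}
               (bip : ∀ j → IsBipartite cls (H j)) (shape : IsSubgraphShape S) (root : IsRootSet cls S X)
               (ext : Extendable cls H S X d m) (1≤d : 1 ≤ d)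
               {i : Fin 2} {x y : Fin n} (x∈S : x ∈ V S) (clsx : cls x ≡ i) (deg<d : deg S x < d)
               (Hxy : H i x y ≡ true) (y∉S : y ∉ V S) (uncovered : ¬ TightSets.Covered ext i x y) where

  open Extendable ext
  open IsSubgraphShape shape renaming (simple to S-simple; inside to S-inside)
  open TightSets ext i x using (mkTight)

  x≢y : x ≢ y
  x≢y refl = y∉S x∈S

  y∉X : y ∉ X
  y∉X y∈X = y∉S (proj₁ (proj₁ root y y∈X))

  no-edge-from-y : ∀ w → E S y w ≡ false
  no-edge-from-y w = ¬-not (y∉S ∘ S-inside y w)

  no-edge-to-y : ∀ w → E S w y ≡ false
  no-edge-to-y w = trans (IsSimple.sym S-simple w y) (no-edge-from-y w)

  open FreshLeaf S X x y x≢y y∉X no-edge-from-y no-edge-to-y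

  crossing : ∀ {u v} → E S u v ≡ true → cls u ≢ cls v
  crossing {u} {v} uv =
    IsBipartite.crosses (bip _) u v (sub _ u v (∧≡true⁺ uv (parityOk-parity (dist S X u v))))

  new-edge-parity : parityₓ ≡ i
  new-edge-parity with proj₁ (proj₂ root) x x∈S
  ... | r , r∈X , _ , walk =
    trans (sym (distToX-parity S X cls (λ r∈X → ∈-class⁺ (proj₂ (proj₁ root _ r∈X))) crossing walk r∈X)) clsx

  clsy : cls y ≡ other i
  clsy = subst (λ c → cls y ≡ other c) clsx (≢⇒≡other (IsBipartite.crosses (bip i) x y Hxy))

  maxDeg′ : ∀ v → deg S′ v ≤ d
  maxDeg′ v = by-cases (v ≟ᶠ x) (v ≟ᶠ y)
    where
    by-cases : Dec (v ≡ x) → Dec (v ≡ y) → deg S′ v ≤ d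
    by-cases (yes refl) _          = ≤-trans deg-addEdge-x deg<d
    by-cases (no _)     (yes refl) = ≤-trans deg-addEdge-y 1≤d
    by-cases (no v≢x)   (no v≢y)   = ≤-trans (deg-addEdge v≢x v≢y) (maxDeg v)

  sub′ : ∀ j u v → Sᵢ S′ X j u v ≡ true → H j u v ≡ true
  sub′ j u v s with Sᵢ-addEdge⁻ s
  ... | inj₁ old = sub j u v old
  ... | inj₂ (j≡p , inj₁ (refl , refl)) rewrite trans j≡p new-edge-parity = Hxy
  ... | inj₂ (j≡p , inj₂ (refl , refl)) rewrite trans j≡p new-edge-parity =
    trans (IsSimple.sym (IsBipartite.simple (bip i)) y x) Hxy

  eS-addEdge : ∀ j U → eS cls S X j U ≤ eS cls S′ X j U
  eS-addEdge j U = weight-mono (degInto-addEdge j (class cls (other j))) U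

  eS-addEdge-x : ∀ {U} → x ∈ U → eS cls S X i U < eS cls S′ X i U
  eS-addEdge-x x∈U = weight-mono-< (degInto-addEdge i (class cls (other i))) x∈U
    (subst (λ j → degInto (Sᵢ S X j) (class cls (other i)) x < degInto (Sᵢ S′ X j) (class cls (other i)) x)
           new-edge-parity (degInto-addEdge-x (class cls (other i)) (∈-class⁺ clsy)))

  cost-addEdge-fresh : ∀ j U → y ∉ Nout (H j) U S → cost cls H X j S U ≤ cost cls H X j S′ U
  cost-addEdge-fresh j U y∉N = +-mono-≤ (p⊆q⇒∣p∣≤∣q∣ (Nout-addEdge-fresh (H j) S U x y y∉N)) (eS-addEdge j U)

  cost-addEdge-suc : ∀ j U → cost cls H X j S U ≤ suc (cost cls H X j S′ U)
  cost-addEdge-suc j U = +-mono-≤ (∣Nout∣≤1+∣Nout-addEdge∣ (H j) S U x y) (eS-addEdge j U)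

  cost-addEdge-x : ∀ {U} → x ∈ U → cost cls H X i S U ≤ cost cls H X i S′ U
  cost-addEdge-x {U} x∈U = begin
    ∣ Nout (H i) U S ∣ + eS cls S X i U          ≤⟨ +-monoˡ-≤ _ (∣Nout∣≤1+∣Nout-addEdge∣ (H i) S U x y) ⟩
    suc ∣ Nout (H i) U S′ ∣ + eS cls S X i U     ≡⟨ +-suc (∣ Nout (H i) U S′ ∣) (eS cls S X i U) ⟨
    ∣ Nout (H i) U S′ ∣ + suc (eS cls S X i U)   ≤⟨ +-monoʳ-≤ (∣ Nout (H i) U S′ ∣) (eS-addEdge-x x∈U) ⟩
    ∣ Nout (H i) U S′ ∣ + eS cls S′ X i U        ∎
    where open ≤-Reasoning

  neighbour-class : ∀ {j U} → U ⊆ class cls j → y ∈ Nout (H j) U S → j ≡ i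
  neighbour-class {j} {U} U⊆Aⱼ y∈N with ∈Nout⁻ (H j) S U y∈N
  ... | (u , u∈U , Huy) , _ = other-injective (begin
    other j       ≡⟨ cong other (∈-class⁻ (U⊆Aⱼ u∈U)) ⟨
    other (cls u) ≡⟨ ≢⇒≡other (IsBipartite.crosses (bip j) u y Huy) ⟨
    cls y         ≡⟨ clsy ⟩
    other i       ∎)
    where open ≡-Reasoning

  -- A set that loses the new neighbour y lies in A_i; the edge xy pays for y if x ∈ U, and
  -- otherwise U is not tight, so it had slack.
  expand′ : ∀ j U → U ⊆ class cls j → 0 < ∣ U ∣ → ∣ U ∣ ≤ 2 * m → d * ∣ U ∣ ≤ cost cls H X j S′ U
  expand′ j U U⊆Aⱼ nonempty small with y ∈? Nout (H j) U S
  ... | no y∉N = ≤-trans (expand j U U⊆Aⱼ nonempty small) (cost-addEdge-fresh j U y∉N)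
  ... | yes y∈N with neighbour-class U⊆Aⱼ y∈N
  ...   | refl with x ∈? U
  ...     | yes x∈U = ≤-trans (expand i U U⊆Aⱼ nonempty small) (cost-addEdge-x x∈U)
  ...     | no  x∉U = ≤-pred (≤-trans not-tight (cost-addEdge-suc i U))
    where not-tight : d * ∣ U ∣ < cost cls H X i S U
          not-tight = ≰⇒> (λ tight → uncovered (U , mkTight U⊆Aⱼ x∉U small tight , y∈N))

  extendable : Extendable cls H S′ X d m
  extendable = record { maxDeg = maxDeg′ ; sub = sub′ ; expand = expand′ ; large = large }

lemma4p3 : ∀ {n} (d m : ℕ) → 2 ≤ d → 1 ≤ m →
    (cls : Fin n → Fin 2) (H : Fin 2 → Adj n) → (∀ i → IsBipartite cls (H i)) →
    (S : Graph n) (X : Subset n) → IsForest S → IsRootSet cls S X →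
    Extendable cls H S X d m →
    2 * ∣ V S ∣ + 4 * d * m + 4 ≤ ∣ class cls zero ∣ →
    2 * ∣ V S ∣ + 4 * d * m + 4 ≤ ∣ class cls (suc zero) ∣ →
    ∀ (i : Fin 2) (x : Fin n) → x ∈ V S → cls x ≡ i → deg S x < d →
    ∃[ y ] (H i x y ≡ true × y ∉ V S × Extendable cls H (addEdge S x y) X d m)
lemma4p3 d m 2≤d _ cls H bip S X (shape , _) root ext big₁ big₂ i x x∈S clsx deg<d
  with TightSets.uncovered-neighbour ext i x (room i) clsx deg<d
  where
  room : ∀ j → 2 * ∣ V S ∣ + 4 * d * m < ∣ class cls (other j) ∣
  room zero       = <-≤-trans (m<m+n _ (s≤s z≤n)) big₂
  room (suc zero) = <-≤-trans (m<m+n _ (s≤s z≤n)) big₁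
... | y , y∈N , uncovered with ∈Nout⁅⁆⁻ (H i) S y∈N
...   | Hxy , y∉S = y , Hxy , y∉S ,
  AddLeaf.extendable bip shape root ext (≤-trans (s≤s z≤n) 2≤d) x∈S clsx deg<d Hxy y∉S uncovered
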